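{- For an integer $k\ge 2$, let $H_k$ be the graph with vertex set $\{z,w\}\cup\{x_i,y_i: i\in\{1,\dots,k\}\}$ and edge set $\{zw\}\cup\{wx_i,\,x_iy_i,\,y_iz: i\in\{1,\dots,k\}\}$ (so that $x_iy_izwx_i$ is a 4-cycle for every $i$), and let $e$ denote the edge $zw$. Then (i) $\mu(H_k)=\mu_o(H_k)=\mu_d(H_k)=\mu_t(H_k)=2k$; (ii) $\mu(H_k-e)=k+1$ and $\mu_o(H_k-e)=k$; (iii) $\mu_d(H_k-e)=2$ and $\mu_t(H_k-e)=0$.
   Context: For a connected graph $G$ and $X\subseteq V(G)$, two vertices $u,v$ are $X$-visible if there is a shortest $u,v$-path $P$ in $G$ with $V(P)\cap X\subseteq\{u,v\}$. $X$ is a mutual-visibility set if all $u,v\in X$ are $X$-visible; an outer mutual-visibility set if all $u\in X$, $v\in V(G)$ are $X$-visible; a dual mutual-visibility set if all $u,v$ with $u,v\in X$ or $u,v\in V(G)\setminus X$ are $X$-visible; a total mutual-visibility set if all $u,v\in V(G)$ are $X$-visible. $\mu(G),\mu_o(G),\mu_d(G),\mu_t(G)$ denote the maximum cardinalities of such sets, respectively (the empty set is allowed). -}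

module Defs where

open import Data.Nat using (ℕ; zero; suc; _+_; _≤_)
open import Data.Fin using (Fin; zero; suc; _↑ˡ_; _↑ʳ_)
open import Data.Fin.Subset using (Subset; _∈_; _∉_; ∣_∣)
open import Data.List using (List; []; _∷_)
open import Data.List.Membership.Propositional using () renaming (_∈_ to _∈ₗ_)
open import Data.Product using (Σ; ∃; _×_; _,_)
open import Data.Sum using (_⊎_)
open import Relation.Binary.PropositionalEquality using (_≡_)
open import Relation.Nullary using (¬_)

Graph : ℕ → Set₁
Graph n = Fin n → Fin n → Set

data Walk {n : ℕ} (G : Graph n) : Fin n → Fin n → ℕ → Set where
  []  : ∀ {u} → Walk G u u 0
  _∷_ : ∀ {u v w l} → G u v → Walk G v w l → Walk G u w (suc l)

verts : ∀ {n} {G : Graph n} {u v l} → Walk G u v l → List (Fin n)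
verts {u = u} []      = u ∷ []
verts {u = u} (_ ∷ p) = u ∷ verts p

IsShortest : ∀ {n} {G : Graph n} {u v l} → Walk G u v l → Set
IsShortest {n} {G} {u} {v} {l} _ = ∀ m → Walk G u v m → l ≤ m

Visible : ∀ {n} → Graph n → Subset n → Fin n → Fin n → Set
Visible {n} G X u v =
  Σ ℕ λ l → Σ (Walk G u v l) λ p →
    IsShortest p × (∀ t → t ∈ₗ verts p → t ∈ X → t ≡ u ⊎ t ≡ v)

IsMutualVis : ∀ {n} → Graph n → Subset n → Set
IsMutualVis G X = ∀ u v → u ∈ X → v ∈ X → Visible G X u v

IsOuterMutualVis : ∀ {n} → Graph n → Subset n → Set
IsOuterMutualVis G X = ∀ u v → u ∈ X → Visible G X u v

IsDualMutualVis : ∀ {n} → Graph n → Subset n → Set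
IsDualMutualVis G X =
  ∀ u v → (u ∈ X × v ∈ X) ⊎ (u ∉ X × v ∉ X) → Visible G X u v

IsTotalMutualVis : ∀ {n} → Graph n → Subset n → Set
IsTotalMutualVis G X = ∀ u v → Visible G X u v

IsMaxCard : ∀ {n} → (Subset n → Set) → ℕ → Set
IsMaxCard P m = (Σ _ λ X → P X × ∣ X ∣ ≡ m) × (∀ X → P X → ∣ X ∣ ≤ m)

μ≡ μo≡ μd≡ μt≡ : ∀ {n} → Graph n → ℕ → Set
μ≡  G = IsMaxCard (IsMutualVis G)
μo≡ G = IsMaxCard (IsOuterMutualVis G)
μd≡ G = IsMaxCard (IsDualMutualVis G)
μt≡ G = IsMaxCard (IsTotalMutualVis G)

deleteEdge : ∀ {n} → Graph n → Fin n → Fin n → Graph n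
deleteEdge G a b u v = G u v × ¬ ((u ≡ a × v ≡ b) ⊎ (u ≡ b × v ≡ a))

-- The graph H_k on Fin (2 + (k + k)):
-- z = 0, w = 1, x_i = 2 + i, y_i = 2 + k + i  (i : Fin k).
module _ (k : ℕ) where
  Vtx : Set
  Vtx = Fin (2 + (k + k))

  zv wv : Vtx
  zv = zero
  wv = suc zero

  xv yv : Fin k → Vtx
  xv i = suc (suc (i ↑ˡ k))
  yv i = suc (suc (k ↑ʳ i))

data HEdge (k : ℕ) : Vtx k → Vtx k → Set where
  e-zw : HEdge k (zv k) (wv k)
  e-wx : ∀ i → HEdge k (wv k) (xv k i)
  e-xy : ∀ i → HEdge k (xv k i) (yv k i)
  e-yz : ∀ i → HEdge k (yv k i) (zv k)

H : (k : ℕ) → Graph (2 + (k + k))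
H k u v = HEdge k u v ⊎ HEdge k v u

H-e : (k : ℕ) → Graph (2 + (k + k))
H-e k = deleteEdge (H k) (zv k) (wv k)

-- Distances in H_k and in H_k - zw are explicit, and between two vertices at distance 2 or 3 there
-- are only one or two shortest paths. So the visibility of such a pair forces one specific interior
-- vertex (or one of two specific pairs of vertices) out of X: two x-vertices see each other only
-- through w, two y-vertices only through z, and in H_k - zw the vertices z and x_i only through y_i,
-- w and y_i only through x_i, z and w only through a rung x_i y_i lying outside X. Describing X by
-- its hub vertices z, w and the index sets xs, ys of its x- and y-vertices, these exclusions bound
-- |xs| + |ys| = |xs ∪ ys| + |xs ∩ ys| case by case on the hubs. The bounds are attained by explicit
-- sets whose visibility is checked along explicit shortest routes.

module Submission where

open import Defs
open import Data.Bool using (Bool; true; false; if_then_else_; T)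
open import Data.Empty using (⊥; ⊥-elim)
open import Data.Fin using (Fin; zero; suc; _↑ˡ_; _↑ʳ_; splitAt; _≟_)
open import Data.Fin.Properties using (splitAt-↑ˡ; splitAt-↑ʳ; join-splitAt; 0≢1+n; suc-injective)
open import Data.Fin.Subset using (Subset; Side; inside; outside; _∈_; _∉_; _⊆_; ∣_∣; _∪_; _∩_; Empty)
open import Data.Fin.Subset.Properties
  using (∣p∣≤n; ∣⊥∣≡0; ∣⊤∣≡n; Empty-unique; p⊂q⇒∣p∣<∣q∣; p⊆q⇒∣p∣≤∣q∣; ⊆⊤; ∈⊤; x∈p∩q⁻; x∈p∩q⁺; x∈p∪q⁻; _∈?_)
open import Data.List using (List; []; _∷_)
open import Data.List.Relation.Unary.All as All using (All; []; _∷_)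
open import Data.List.Relation.Unary.Any using () renaming (here to hereₗ; there to thereₗ)
open import Data.List.Membership.Propositional using () renaming (_∈_ to _∈ₗ_)
open import Data.Nat using (ℕ; zero; suc; _+_; _≤_; _<_; _≤ᵇ_; z≤n; s≤s)
open import Data.Nat.Properties
  using (≤ᵇ⇒≤; ≤-trans; ≤-reflexive; ≤-antisym; +-mono-≤; +-suc; +-comm; +-identityʳ)
open import Data.Product using (Σ; _×_; _,_; proj₁; proj₂)
open import Data.Sum using (_⊎_; inj₁; inj₂; [_,_])
import Data.Vec as Vec
open import Data.Vec using ([]; _∷_; here; there; _++_; lookup; tabulate; replicate)
open import Data.Vec.Properties
  using (lookup-++ˡ; lookup-++ʳ; []=⇒lookup; lookup⇒[]=; lookup∘tabulate; tabulate-∘; map-const)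
open import Function using (_∘_; id)
open import Relation.Binary.PropositionalEquality
  using (_≡_; _≢_; refl; sym; trans; cong; cong₂; subst; subst₂; module ≡-Reasoning)
open import Relation.Nullary using (¬_; does; yes; no)
open import Relation.Nullary.Decidable using (dec-true; dec-false)

≤-eval : ∀ {m n} {_ : T (m ≤ᵇ n)} → m ≤ n
≤-eval {m} {n} {m≤ᵇn} = ≤ᵇ⇒≤ m n m≤ᵇn

module _ {n} {G : Graph n} {X : Subset n} where

  IsTotalMutualVis⇒IsOuterMutualVis : IsTotalMutualVis G X → IsOuterMutualVis G X
  IsTotalMutualVis⇒IsOuterMutualVis total u v _ = total u v

  IsTotalMutualVis⇒IsDualMutualVis : IsTotalMutualVis G X → IsDualMutualVis G X
  IsTotalMutualVis⇒IsDualMutualVis total u v _ = total u v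

  IsOuterMutualVis⇒IsMutualVis : IsOuterMutualVis G X → IsMutualVis G X
  IsOuterMutualVis⇒IsMutualVis outer u v u∈X _ = outer u v u∈X

  IsDualMutualVis⇒IsMutualVis : IsDualMutualVis G X → IsMutualVis G X
  IsDualMutualVis⇒IsMutualVis dual u v u∈X v∈X = dual u v (inj₁ (u∈X , v∈X))

∣p++q∣≡∣p∣+∣q∣ : ∀ {m n} (p : Subset m) (q : Subset n) → ∣ p ++ q ∣ ≡ ∣ p ∣ + ∣ q ∣
∣p++q∣≡∣p∣+∣q∣ []            q = refl
∣p++q∣≡∣p∣+∣q∣ (outside ∷ p) q = ∣p++q∣≡∣p∣+∣q∣ p q
∣p++q∣≡∣p∣+∣q∣ (inside  ∷ p) q = cong suc (∣p++q∣≡∣p∣+∣q∣ p q)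

∣p∣+∣q∣≡∣p∪q∣+∣p∩q∣ : ∀ {n} (p q : Subset n) → ∣ p ∣ + ∣ q ∣ ≡ ∣ p ∪ q ∣ + ∣ p ∩ q ∣
∣p∣+∣q∣≡∣p∪q∣+∣p∩q∣ []            []            = refl
∣p∣+∣q∣≡∣p∪q∣+∣p∩q∣ (outside ∷ p) (outside ∷ q) = ∣p∣+∣q∣≡∣p∪q∣+∣p∩q∣ p q
∣p∣+∣q∣≡∣p∪q∣+∣p∩q∣ (outside ∷ p) (inside  ∷ q) =
  trans (+-suc ∣ p ∣ ∣ q ∣) (cong suc (∣p∣+∣q∣≡∣p∪q∣+∣p∩q∣ p q))
∣p∣+∣q∣≡∣p∪q∣+∣p∩q∣ (inside  ∷ p) (outside ∷ q) = cong suc (∣p∣+∣q∣≡∣p∪q∣+∣p∩q∣ p q)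
∣p∣+∣q∣≡∣p∪q∣+∣p∩q∣ (inside  ∷ p) (inside  ∷ q) = cong suc (begin
  ∣ p ∣ + suc ∣ q ∣           ≡⟨ +-suc ∣ p ∣ ∣ q ∣ ⟩
  suc (∣ p ∣ + ∣ q ∣)         ≡⟨ cong suc (∣p∣+∣q∣≡∣p∪q∣+∣p∩q∣ p q) ⟩
  suc (∣ p ∪ q ∣ + ∣ p ∩ q ∣) ≡⟨ sym (+-suc ∣ p ∪ q ∣ ∣ p ∩ q ∣) ⟩
  ∣ p ∪ q ∣ + suc ∣ p ∩ q ∣   ∎)
  where open ≡-Reasoning

Empty⇒∣p∣≡0 : ∀ {n} {p : Subset n} → Empty p → ∣ p ∣ ≡ 0
Empty⇒∣p∣≡0 {n} e = trans (cong ∣_∣ (Empty-unique e)) (∣⊥∣≡0 n)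

∣p∣≤1 : ∀ {n} {p : Subset n} → (∀ {i j} → i ≢ j → i ∈ p → j ∈ p → ⊥) → ∣ p ∣ ≤ 1
∣p∣≤1 {p = []}          _      = z≤n
∣p∣≤1 {p = outside ∷ p} sparse =
  ∣p∣≤1 λ i≢j i∈p j∈p → sparse (i≢j ∘ suc-injective) (there i∈p) (there j∈p)
∣p∣≤1 {p = inside  ∷ p} sparse =
  s≤s (≤-reflexive (Empty⇒∣p∣≡0 λ (_ , i∈p) → sparse 0≢1+n here (there i∈p)))

x∉p⇒∣p∣<n : ∀ {n} {p : Subset n} {i} → i ∉ p → ∣ p ∣ < n
x∉p⇒∣p∣<n {n} {p} {i} i∉p = subst (∣ p ∣ <_) (∣⊤∣≡n n) (p⊂q⇒∣p∣<∣q∣ (⊆⊤ , i , ∈⊤ , i∉p))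

module _ {n} (p q : Subset n) where

  disjoint⇒∣p∣+∣q∣≡∣p∪q∣ : Empty (p ∩ q) → ∣ p ∣ + ∣ q ∣ ≡ ∣ p ∪ q ∣
  disjoint⇒∣p∣+∣q∣≡∣p∪q∣ disjoint = begin
    ∣ p ∣ + ∣ q ∣         ≡⟨ ∣p∣+∣q∣≡∣p∪q∣+∣p∩q∣ p q ⟩
    ∣ p ∪ q ∣ + ∣ p ∩ q ∣ ≡⟨ cong (∣ p ∪ q ∣ +_) (Empty⇒∣p∣≡0 {p = p ∩ q} disjoint) ⟩
    ∣ p ∪ q ∣ + 0         ≡⟨ +-identityʳ ∣ p ∪ q ∣ ⟩
    ∣ p ∪ q ∣             ∎
    where open ≡-Reasoning

  disjoint⇒∣p∣+∣q∣≤n : Empty (p ∩ q) → ∣ p ∣ + ∣ q ∣ ≤ n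
  disjoint⇒∣p∣+∣q∣≤n disjoint = subst (_≤ n) (sym (disjoint⇒∣p∣+∣q∣≡∣p∪q∣ disjoint)) (∣p∣≤n (p ∪ q))

  disjoint⇒∣p∣+∣q∣<n : ∀ {i} → Empty (p ∩ q) → i ∉ p ∪ q → ∣ p ∣ + ∣ q ∣ < n
  disjoint⇒∣p∣+∣q∣<n disjoint i∉p∪q =
    subst (_< n) (sym (disjoint⇒∣p∣+∣q∣≡∣p∪q∣ disjoint)) (x∉p⇒∣p∣<n i∉p∪q)

  ∣p∩q∣≤1⇒∣p∣+∣q∣≤1+n : ∣ p ∩ q ∣ ≤ 1 → ∣ p ∣ + ∣ q ∣ ≤ 1 + n
  ∣p∩q∣≤1⇒∣p∣+∣q∣≤1+n ∣p∩q∣≤1 = subst (_≤ 1 + n) (sym (∣p∣+∣q∣≡∣p∪q∣+∣p∩q∣ p q))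
    (≤-trans (+-mono-≤ (∣p∣≤n (p ∪ q)) ∣p∩q∣≤1) (≤-reflexive (+-comm n 1)))

-- Interior vertices of short visible walks

Avoids : ∀ {n} → Subset n → Fin n → Fin n → List (Fin n) → Set
Avoids X u v ts = ∀ t → t ∈ₗ ts → t ∈ X → t ≡ u ⊎ t ≡ v

module _ {n} {G : Graph n} (loopless : ∀ {t} → ¬ G t t) {X : Subset n} where

  midpoint∉ : ∀ {u v} (q : Walk G u v 2) → Avoids X u v (verts q) →
              Σ (Fin n) λ m → G u m × G m v × m ∉ X
  midpoint∉ (e₁ ∷ e₂ ∷ []) avoids = _ , e₁ , e₂ , m∉X
    where
    m∉X : _ ∉ X
    m∉X m∈X with avoids _ (thereₗ (hereₗ refl)) m∈X
    ... | inj₁ refl = loopless e₁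
    ... | inj₂ refl = loopless e₂

  interior₃∉ : ∀ {u v} → ¬ G u v → (q : Walk G u v 3) → Avoids X u v (verts q) →
               Σ (Fin n) λ m₁ → Σ (Fin n) λ m₂ → G u m₁ × G m₁ m₂ × G m₂ v × m₁ ∉ X × m₂ ∉ X
  interior₃∉ ¬uv (e₁ ∷ e₂ ∷ e₃ ∷ []) avoids = _ , _ , e₁ , e₂ , e₃ , m₁∉X , m₂∉X
    where
    m₁∉X : _ ∉ X
    m₁∉X m₁∈X with avoids _ (thereₗ (hereₗ refl)) m₁∈X
    ... | inj₁ refl = loopless e₁
    ... | inj₂ refl = ¬uv e₁
    m₂∉X : _ ∉ X
    m₂∉X m₂∈X with avoids _ (thereₗ (thereₗ (hereₗ refl))) m₂∈X
    ... | inj₁ refl = ¬uv e₃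
    ... | inj₂ refl = loopless e₃

data V (k : ℕ) : Set where
  vz vw : V k
  vx vy : Fin k → V k

-- Adj true is the adjacency relation of H_k, and Adj false that of H_k - zw.
data Adj {k : ℕ} : Bool → V k → V k → Set where
  zw : Adj true vz vw
  wz : Adj true vw vz
  wx : ∀ {b} i → Adj b vw (vx i)
  xw : ∀ {b} i → Adj b (vx i) vw
  xy : ∀ {b} i → Adj b (vx i) (vy i)
  yx : ∀ {b} i → Adj b (vy i) (vx i)
  yz : ∀ {b} i → Adj b (vy i) vz
  zy : ∀ {b} i → Adj b vz (vy i)

Adj-irrefl : ∀ {k b} {a : V k} → ¬ Adj b a a
Adj-irrefl ()

Adj-sym : ∀ {k b} {a c : V k} → Adj b a c → Adj b c a
Adj-sym zw     = wz
Adj-sym wz     = zw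
Adj-sym (wx i) = xw i
Adj-sym (xw i) = wx i
Adj-sym (xy i) = yx i
Adj-sym (yx i) = xy i
Adj-sym (yz i) = zy i
Adj-sym (zy i) = yz i

HG : Bool → (k : ℕ) → Graph (2 + (k + k))
HG true  = H
HG false = H-e

module _ {k : ℕ} where

  VSubset : Set
  VSubset = Subset (2 + (k + k))

  toVtx : V k → Vtx k
  toVtx vz     = zv k
  toVtx vw     = wv k
  toVtx (vx i) = xv k i
  toVtx (vy i) = yv k i

  fromVtx : Vtx k → V k
  fromVtx zero          = vz
  fromVtx (suc zero)    = vw
  fromVtx (suc (suc r)) = [ vx , vy ] (splitAt k r)

  fromVtx∘toVtx : ∀ a → fromVtx (toVtx a) ≡ a
  fromVtx∘toVtx vz     = refl
  fromVtx∘toVtx vw     = refl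
  fromVtx∘toVtx (vx i) = cong [ vx , vy ] (splitAt-↑ˡ k i k)
  fromVtx∘toVtx (vy i) = cong [ vx , vy ] (splitAt-↑ʳ k k i)

  toVtx∘fromVtx : ∀ u → toVtx (fromVtx u) ≡ u
  toVtx∘fromVtx zero          = refl
  toVtx∘fromVtx (suc zero)    = refl
  toVtx∘fromVtx (suc (suc r)) with splitAt k r | join-splitAt k k r
  ... | inj₁ i | r≡ = cong (λ r → suc (suc r)) r≡
  ... | inj₂ i | r≡ = cong (λ r → suc (suc r)) r≡

  ∀-toVtx : {P : Vtx k → Vtx k → Set} → (∀ a c → P (toVtx a) (toVtx c)) → ∀ u v → P u v
  ∀-toVtx {P} h u v = subst₂ P (toVtx∘fromVtx u) (toVtx∘fromVtx v) (h (fromVtx u) (fromVtx v))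

  edge⇒Adj : ∀ {b u v} → HEdge k u v → (b ≡ false → ¬ (u ≡ zv k × v ≡ wv k)) → Adj b (fromVtx u) (fromVtx v)
  edge⇒Adj {true}  e-zw _ = zw
  edge⇒Adj {false} e-zw ¬zw = ⊥-elim (¬zw refl (refl , refl))
  edge⇒Adj (e-wx i) _ rewrite splitAt-↑ˡ k i k = wx i
  edge⇒Adj (e-xy i) _ rewrite splitAt-↑ˡ k i k | splitAt-↑ʳ k k i = xy i
  edge⇒Adj (e-yz i) _ rewrite splitAt-↑ʳ k k i = yz i

  HG⇒Adj : ∀ b {u v} → HG b k u v → Adj b (fromVtx u) (fromVtx v)
  HG⇒Adj true  (inj₁ e)       = edge⇒Adj e λ ()
  HG⇒Adj true  (inj₂ e)       = Adj-sym (edge⇒Adj e λ ())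
  HG⇒Adj false (inj₁ e , ¬zw) = edge⇒Adj e λ _ u≡z×v≡w → ¬zw (inj₁ u≡z×v≡w)
  HG⇒Adj false (inj₂ e , ¬zw) = Adj-sym (edge⇒Adj e λ _ (v≡z , u≡w) → ¬zw (inj₂ (u≡w , v≡z)))

  HG-loopless : ∀ {b u} → ¬ HG b k u u
  HG-loopless {b} e = Adj-irrefl (HG⇒Adj b e)

  Adj⇒H : ∀ {b a c} → Adj b a c → H k (toVtx a) (toVtx c)
  Adj⇒H zw     = inj₁ e-zw
  Adj⇒H wz     = inj₂ e-zw
  Adj⇒H (wx i) = inj₁ (e-wx i)
  Adj⇒H (xw i) = inj₂ (e-wx i)
  Adj⇒H (xy i) = inj₁ (e-xy i)
  Adj⇒H (yx i) = inj₂ (e-xy i)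
  Adj⇒H (yz i) = inj₁ (e-yz i)
  Adj⇒H (zy i) = inj₂ (e-yz i)

  Adj⇒H-e : ∀ {a c} → Adj false a c → H-e k (toVtx a) (toVtx c)
  Adj⇒H-e e = Adj⇒H e , not-zw e
    where
    not-zw : ∀ {a c} → Adj false a c →
             ¬ ((toVtx a ≡ zv k × toVtx c ≡ wv k) ⊎ (toVtx a ≡ wv k × toVtx c ≡ zv k))
    not-zw (wx i) = λ { (inj₁ (() , _)) ; (inj₂ (_ , ())) }
    not-zw (xw i) = λ { (inj₁ (() , _)) ; (inj₂ (() , _)) }
    not-zw (xy i) = λ { (inj₁ (() , _)) ; (inj₂ (() , _)) }
    not-zw (yx i) = λ { (inj₁ (() , _)) ; (inj₂ (() , _)) }
    not-zw (yz i) = λ { (inj₁ (() , _)) ; (inj₂ (() , _)) }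
    not-zw (zy i) = λ { (inj₁ (_ , ())) ; (inj₂ (() , _)) }

  Adj⇒HG : ∀ {b a c} → Adj b a c → HG b k (toVtx a) (toVtx c)
  Adj⇒HG {true}  = Adj⇒H
  Adj⇒HG {false} = Adj⇒H-e

  -- Distances and shortest routes

  -- Once zw is deleted, z and w are joined around one of the 4-cycles.
  d-zw : Bool → ℕ
  d-zw true  = 1
  d-zw false = 3

  1≤d-zw : ∀ b → 1 ≤ d-zw b
  1≤d-zw true  = ≤-eval
  1≤d-zw false = ≤-eval

  d-zw≤3 : ∀ b → d-zw b ≤ 3
  d-zw≤3 true  = ≤-eval
  d-zw≤3 false = ≤-eval

  if-≤ : ∀ d {a b n} → a ≤ n → b ≤ n → (if d then a else b) ≤ n
  if-≤ true  a≤n _   = a≤n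
  if-≤ false _   b≤n = b≤n

  ≤-suc-if : ∀ d {a b n} → n ≤ suc a → n ≤ suc b → n ≤ suc (if d then a else b)
  ≤-suc-if true  n≤a _   = n≤a
  ≤-suc-if false _   n≤b = n≤b

  if-≤-suc-if : ∀ d {a b c e} → a ≤ suc c → b ≤ suc e → (if d then a else b) ≤ suc (if d then c else e)
  if-≤-suc-if true  a≤c _   = a≤c
  if-≤-suc-if false _   b≤e = b≤e

  dist : Bool → V k → V k → ℕ
  dist b vz     vz     = 0
  dist b vz     vw     = d-zw b
  dist b vz     (vx _) = 2
  dist b vz     (vy _) = 1
  dist b vw     vz     = d-zw b
  dist b vw     vw     = 0
  dist b vw     (vx _) = 1
  dist b vw     (vy _) = 2
  dist b (vx _) vz     = 2
  dist b (vx _) vw     = 1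
  dist b (vx i) (vx j) = if does (i ≟ j) then 0 else 2
  dist b (vx i) (vy j) = if does (i ≟ j) then 1 else 3
  dist b (vy _) vz     = 1
  dist b (vy _) vw     = 2
  dist b (vy i) (vx j) = if does (i ≟ j) then 1 else 3
  dist b (vy i) (vy j) = if does (i ≟ j) then 0 else 2

  dist-refl : ∀ b a → dist b a a ≡ 0
  dist-refl b vz     = refl
  dist-refl b vw     = refl
  dist-refl b (vx i) rewrite dec-true (i ≟ i) refl = refl
  dist-refl b (vy i) rewrite dec-true (i ≟ i) refl = refl

  dist-step : ∀ {b a c} → Adj b a c → ∀ t → dist b a t ≤ suc (dist b c t)
  dist-step     zw     vz     = ≤-eval
  dist-step     zw     vw     = ≤-eval
  dist-step     zw     (vx j) = ≤-eval
  dist-step     zw     (vy j) = ≤-eval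
  dist-step     wz     vz     = ≤-eval
  dist-step     wz     vw     = ≤-eval
  dist-step     wz     (vx j) = ≤-eval
  dist-step     wz     (vy j) = ≤-eval
  dist-step {b} (wx i) vz     = d-zw≤3 b
  dist-step     (wx i) vw     = ≤-eval
  dist-step     (wx i) (vx j) = ≤-suc-if (does (i ≟ j)) ≤-eval ≤-eval
  dist-step     (wx i) (vy j) = ≤-suc-if (does (i ≟ j)) ≤-eval ≤-eval
  dist-step {b} (xw i) vz     = s≤s (1≤d-zw b)
  dist-step     (xw i) vw     = ≤-eval
  dist-step     (xw i) (vx j) = if-≤ (does (i ≟ j)) ≤-eval ≤-eval
  dist-step     (xw i) (vy j) = if-≤ (does (i ≟ j)) ≤-eval ≤-eval
  dist-step     (xy i) vz     = ≤-eval
  dist-step     (xy i) vw     = ≤-eval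
  dist-step     (xy i) (vx j) = if-≤-suc-if (does (i ≟ j)) ≤-eval ≤-eval
  dist-step     (xy i) (vy j) = if-≤-suc-if (does (i ≟ j)) ≤-eval ≤-eval
  dist-step     (yx i) vz     = ≤-eval
  dist-step     (yx i) vw     = ≤-eval
  dist-step     (yx i) (vx j) = if-≤-suc-if (does (i ≟ j)) ≤-eval ≤-eval
  dist-step     (yx i) (vy j) = if-≤-suc-if (does (i ≟ j)) ≤-eval ≤-eval
  dist-step     (yz i) vz     = ≤-eval
  dist-step {b} (yz i) vw     = s≤s (1≤d-zw b)
  dist-step     (yz i) (vx j) = if-≤ (does (i ≟ j)) ≤-eval ≤-eval
  dist-step     (yz i) (vy j) = if-≤ (does (i ≟ j)) ≤-eval ≤-eval
  dist-step     (zy i) vz     = ≤-eval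
  dist-step {b} (zy i) vw     = d-zw≤3 b
  dist-step     (zy i) (vx j) = ≤-suc-if (does (i ≟ j)) ≤-eval ≤-eval
  dist-step     (zy i) (vy j) = ≤-suc-if (does (i ≟ j)) ≤-eval ≤-eval

  dist≤length : ∀ b {u v l} → Walk (HG b k) u v l → dist b (fromVtx u) (fromVtx v) ≤ l
  dist≤length b {u} []       = ≤-reflexive (dist-refl b (fromVtx u))
  dist≤length b {v = v} (e ∷ q) = ≤-trans (dist-step (HG⇒Adj b e) (fromVtx v)) (s≤s (dist≤length b q))

  dist≤length′ : ∀ {b a c l} → Walk (HG b k) (toVtx a) (toVtx c) l → dist b a c ≤ l
  dist≤length′ {b} {a} {c} {l} q =
    subst₂ (λ a c → dist b a c ≤ l) (fromVtx∘toVtx a) (fromVtx∘toVtx c) (dist≤length b q)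

  dist≡3⇒¬HG : ∀ {b a c} → dist b a c ≡ 3 → ¬ HG b k (toVtx a) (toVtx c)
  dist≡3⇒¬HG {b} {a} {c} d e with subst (_≤ 1) d (dist≤length′ {b} {a} {c} (e ∷ []))
  ... | s≤s ()

  HG⇒Adjˡ : ∀ {b a v} → HG b k (toVtx a) v → Adj b a (fromVtx v)
  HG⇒Adjˡ {b} {a} {v} e = subst (λ a → Adj b a (fromVtx v)) (fromVtx∘toVtx a) (HG⇒Adj b e)

  HG⇒Adjʳ : ∀ {b u c} → HG b k u (toVtx c) → Adj b (fromVtx u) c
  HG⇒Adjʳ {b} {u} {c} e = subst (Adj b (fromVtx u)) (fromVtx∘toVtx c) (HG⇒Adj b e)

  ∉-fromVtx : ∀ {X : VSubset} {m} → m ∉ X → toVtx (fromVtx m) ∉ X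
  ∉-fromVtx {X} {m} = subst (_∉ X) (sym (toVtx∘fromVtx m))

  data Path (b : Bool) : V k → V k → ℕ → Set where
    []  : ∀ {a} → Path b a a 0
    _∷_ : ∀ {a m c l} → Adj b a m → Path b m c l → Path b a c (suc l)

  toWalk : ∀ {b a c l} → Path b a c l → Walk (HG b k) (toVtx a) (toVtx c) l
  toWalk []      = []
  toWalk (e ∷ p) = Adj⇒HG e ∷ toWalk p

  interior : ∀ {b a c l} → Path b a c l → List (V k)
  interior []                        = []
  interior (_ ∷ [])                  = []
  interior (_∷_ {m = m} _ p@(_ ∷ _)) = m ∷ interior p

  interior-avoids : ∀ {b a c l} {X : VSubset} (p : Path b a c l) → All (λ s → toVtx s ∉ X) (interior p) →
                    Avoids X (toVtx a) (toVtx c) (verts (toWalk p))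
  interior-avoids []              _             _ (hereₗ t≡a)          _ = inj₁ t≡a
  interior-avoids (_ ∷ [])        _             _ (hereₗ t≡a)          _ = inj₁ t≡a
  interior-avoids (_ ∷ [])        _             _ (thereₗ (hereₗ t≡c)) _ = inj₂ t≡c
  interior-avoids (_ ∷ (_ ∷ _))   _             _ (hereₗ t≡a)          _ = inj₁ t≡a
  interior-avoids (_ ∷ p@(_ ∷ _)) (m∉X ∷ clear) t (thereₗ t∈p) t∈X with interior-avoids p clear t t∈p t∈X
  ... | inj₁ refl = ⊥-elim (m∉X t∈X)
  ... | inj₂ t≡c  = inj₂ t≡c

  shortest-visible : ∀ {b a c} {X : VSubset} (p : Path b a c (dist b a c)) →
                     All (λ s → toVtx s ∉ X) (interior p) → Visible (HG b k) X (toVtx a) (toVtx c)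
  shortest-visible p clear = _ , toWalk p , (λ _ → dist≤length′) , interior-avoids p clear

  routeH : ∀ a c → Path true a c (dist true a c)
  routeH vz     vz     = []
  routeH vz     vw     = zw ∷ []
  routeH vz     (vx i) = zw ∷ wx i ∷ []
  routeH vz     (vy i) = zy i ∷ []
  routeH vw     vz     = wz ∷ []
  routeH vw     vw     = []
  routeH vw     (vx i) = wx i ∷ []
  routeH vw     (vy i) = wz ∷ zy i ∷ []
  routeH (vx i) vz     = xw i ∷ wz ∷ []
  routeH (vx i) vw     = xw i ∷ []
  routeH (vx i) (vx j) with i ≟ j
  ... | yes refl = []
  ... | no _     = xw i ∷ wx j ∷ []
  routeH (vx i) (vy j) with i ≟ j
  ... | yes refl = xy i ∷ []
  ... | no _     = xw i ∷ wz ∷ zy j ∷ []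
  routeH (vy i) vz     = yz i ∷ []
  routeH (vy i) vw     = yz i ∷ zw ∷ []
  routeH (vy i) (vx j) with i ≟ j
  ... | yes refl = yx i ∷ []
  ... | no _     = yz i ∷ zw ∷ wx j ∷ []
  routeH (vy i) (vy j) with i ≟ j
  ... | yes refl = []
  ... | no _     = yz i ∷ zy j ∷ []

  -- z and w are joined around the 4-cycle of the rung j.
  routeH-e : Fin k → ∀ a c → Path false a c (dist false a c)
  routeH-e j vz     vz     = []
  routeH-e j vz     vw     = zy j ∷ yx j ∷ xw j ∷ []
  routeH-e j vz     (vx i) = zy i ∷ yx i ∷ []
  routeH-e j vz     (vy i) = zy i ∷ []
  routeH-e j vw     vz     = wx j ∷ xy j ∷ yz j ∷ []
  routeH-e j vw     vw     = []
  routeH-e j vw     (vx i) = wx i ∷ []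
  routeH-e j vw     (vy i) = wx i ∷ xy i ∷ []
  routeH-e j (vx i) vz     = xy i ∷ yz i ∷ []
  routeH-e j (vx i) vw     = xw i ∷ []
  routeH-e j (vx i) (vx l) with i ≟ l
  ... | yes refl = []
  ... | no _     = xw i ∷ wx l ∷ []
  routeH-e j (vx i) (vy l) with i ≟ l
  ... | yes refl = xy i ∷ []
  ... | no _     = xw i ∷ wx l ∷ xy l ∷ []
  routeH-e j (vy i) vz     = yz i ∷ []
  routeH-e j (vy i) vw     = yx i ∷ xw i ∷ []
  routeH-e j (vy i) (vx l) with i ≟ l
  ... | yes refl = yx i ∷ []
  ... | no _     = yx i ∷ xw i ∷ wx l ∷ []
  routeH-e j (vy i) (vy l) with i ≟ l
  ... | yes refl = []
  ... | no _     = yz i ∷ zy l ∷ []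

  -- A route of H_k - zw only passes through the hubs and the rungs of its endpoints and of j.
  module _ {P : V k → Set} (Pz : P vz) (Pw : P vw)
           (x⇒y : ∀ {i} → P (vx i) → P (vy i)) (y⇒x : ∀ {i} → P (vy i) → P (vx i)) where

    routeH-e-interior : ∀ j a c → P (vx j) → P a → P c → All P (interior (routeH-e j a c))
    routeH-e-interior j vz     vz     _  _  _  = []
    routeH-e-interior j vz     vw     Pj _  _  = x⇒y Pj ∷ Pj ∷ []
    routeH-e-interior j vz     (vx i) _  _  Pc = x⇒y Pc ∷ []
    routeH-e-interior j vz     (vy i) _  _  _  = []
    routeH-e-interior j vw     vz     Pj _  _  = Pj ∷ x⇒y Pj ∷ []
    routeH-e-interior j vw     vw     _  _  _  = []
    routeH-e-interior j vw     (vx i) _  _  _  = []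
    routeH-e-interior j vw     (vy i) _  _  Pc = y⇒x Pc ∷ []
    routeH-e-interior j (vx i) vz     _  Pa _  = x⇒y Pa ∷ []
    routeH-e-interior j (vx i) vw     _  _  _  = []
    routeH-e-interior j (vx i) (vx l) _  _  _  with i ≟ l
    ... | yes refl = []
    ... | no _     = Pw ∷ []
    routeH-e-interior j (vx i) (vy l) _  _  Pc with i ≟ l
    ... | yes refl = []
    ... | no _     = Pw ∷ y⇒x Pc ∷ []
    routeH-e-interior j (vy i) vz     _  _  _  = []
    routeH-e-interior j (vy i) vw     _  Pa _  = y⇒x Pa ∷ []
    routeH-e-interior j (vy i) (vx l) _  Pa _  with i ≟ l
    ... | yes refl = []
    ... | no _     = y⇒x Pa ∷ Pw ∷ []
    routeH-e-interior j (vy i) (vy l) _  _  _  with i ≟ l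
    ... | yes refl = []
    ... | no _     = Pz ∷ []

  -- Vertices that visibility keeps out of X

  visible-length : ∀ {b a c l} {X : VSubset} → Path b a c l → dist b a c ≡ l →
                   (vis : Visible (HG b k) X (toVtx a) (toVtx c)) → proj₁ vis ≡ l
  visible-length {b} {a} {c} p d (_ , q , shortest , _) =
    ≤-antisym (shortest _ (toWalk p)) (subst (_≤ _) d (dist≤length′ {b} {a} {c} q))

  visible-midpoint : ∀ {b a c} {X : VSubset} → Path b a c 2 → dist b a c ≡ 2 →
                     Visible (HG b k) X (toVtx a) (toVtx c) →
                     Σ (V k) λ m → Adj b a m × Adj b m c × toVtx m ∉ X
  visible-midpoint {b} p d vis@(_ , q , _ , avoids) with visible-length p d vis
  ... | refl with midpoint∉ (HG-loopless {b}) q avoids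
  ... | _ , e₁ , e₂ , m∉X = _ , HG⇒Adjˡ e₁ , HG⇒Adjʳ e₂ , ∉-fromVtx m∉X

  visible-interior₃ : ∀ {b a c} {X : VSubset} → Path b a c 3 → dist b a c ≡ 3 →
                      Visible (HG b k) X (toVtx a) (toVtx c) →
                      Σ (V k) λ m₁ → Σ (V k) λ m₂ →
                        Adj b a m₁ × Adj b m₁ m₂ × Adj b m₂ c × toVtx m₁ ∉ X × toVtx m₂ ∉ X
  visible-interior₃ {b} {a} {c} p d vis@(_ , q , _ , avoids) with visible-length p d vis
  ... | refl with interior₃∉ (HG-loopless {b}) (dist≡3⇒¬HG {b} {a} {c} d) q avoids
  ... | _ , _ , e₁ , e₂ , e₃ , m₁∉X , m₂∉X =
    _ , _ , HG⇒Adjˡ e₁ , HG⇒Adj b e₂ , HG⇒Adjʳ e₃ , ∉-fromVtx m₁∉X , ∉-fromVtx m₂∉X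

  sole-midpoint : ∀ {b a c t} {X : VSubset} → Path b a c 2 → dist b a c ≡ 2 →
                  (∀ {m} → Adj b a m → Adj b m c → m ≡ t) →
                  Visible (HG b k) X (toVtx a) (toVtx c) → toVtx t ∉ X
  sole-midpoint p d only vis with visible-midpoint p d vis
  ... | _ , e₁ , e₂ , m∉X with only e₁ e₂
  ... | refl = m∉X

  dist-xx : ∀ {b i j} → i ≢ j → dist b (vx i) (vx j) ≡ 2
  dist-xx {i = i} {j} i≢j rewrite dec-false (i ≟ j) i≢j = refl

  dist-yy : ∀ {b i j} → i ≢ j → dist b (vy i) (vy j) ≡ 2
  dist-yy {i = i} {j} i≢j rewrite dec-false (i ≟ j) i≢j = refl

  dist-xy : ∀ {b i j} → i ≢ j → dist b (vx i) (vy j) ≡ 3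
  dist-xy {i = i} {j} i≢j rewrite dec-false (i ≟ j) i≢j = refl

  module _ {X : VSubset} where

    visible-xx⇒w∉ : ∀ {b i j} → i ≢ j → Visible (HG b k) X (toVtx (vx i)) (toVtx (vx j)) → toVtx vw ∉ X
    visible-xx⇒w∉ {b} {i} {j} i≢j = sole-midpoint {b} (xw i ∷ wx j ∷ []) (dist-xx {b} i≢j)
      λ { (xw _) _ → refl ; (xy _) (yx _) → ⊥-elim (i≢j refl) }

    visible-yy⇒z∉ : ∀ {b i j} → i ≢ j → Visible (HG b k) X (toVtx (vy i)) (toVtx (vy j)) → toVtx vz ∉ X
    visible-yy⇒z∉ {b} {i} {j} i≢j = sole-midpoint {b} (yz i ∷ zy j ∷ []) (dist-yy {b} i≢j)
      λ { (yz _) _ → refl ; (yx _) (xy _) → ⊥-elim (i≢j refl) }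

    visible-zx⇒y∉ : ∀ {i} → Visible (H-e k) X (toVtx vz) (toVtx (vx i)) → toVtx (vy i) ∉ X
    visible-zx⇒y∉ {i} = sole-midpoint {false} (zy i ∷ yx i ∷ []) refl λ { (zy _) (yx _) → refl }

    visible-xz⇒y∉ : ∀ {i} → Visible (H-e k) X (toVtx (vx i)) (toVtx vz) → toVtx (vy i) ∉ X
    visible-xz⇒y∉ {i} = sole-midpoint {false} (xy i ∷ yz i ∷ []) refl λ { (xy _) (yz _) → refl ; (xw _) () }

    visible-wy⇒x∉ : ∀ {i} → Visible (H-e k) X (toVtx vw) (toVtx (vy i)) → toVtx (vx i) ∉ X
    visible-wy⇒x∉ {i} = sole-midpoint {false} (wx i ∷ xy i ∷ []) refl λ { (wx _) (xy _) → refl }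

    visible-zw⇒free-rung : Fin k → Visible (H-e k) X (toVtx vz) (toVtx vw) →
                           Σ (Fin k) λ i → toVtx (vx i) ∉ X × toVtx (vy i) ∉ X
    visible-zw⇒free-rung j vis with visible-interior₃ {false} (zy j ∷ yx j ∷ xw j ∷ []) refl vis
    ... | _ , _ , zy i , yx _ , xw _ , y∉X , x∉X = i , x∉X , y∉X
    ... | _ , _ , zy _ , yz _ , () , _

    visible-wz⇒free-rung : Fin k → Visible (H-e k) X (toVtx vw) (toVtx vz) →
                           Σ (Fin k) λ i → toVtx (vx i) ∉ X × toVtx (vy i) ∉ X
    visible-wz⇒free-rung j vis with visible-interior₃ {false} (wx j ∷ xy j ∷ yz j ∷ []) refl vis
    ... | _ , _ , wx i , xy _ , yz _ , x∉X , y∉X = i , x∉X , y∉X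
    ... | _ , _ , wx _ , xw _ , () , _

    visible-xy⇒free-route : ∀ {i j} → i ≢ j → Visible (H-e k) X (toVtx (vx i)) (toVtx (vy j)) →
                            (toVtx vw ∉ X × toVtx (vx j) ∉ X) ⊎ (toVtx (vy i) ∉ X × toVtx vz ∉ X)
    visible-xy⇒free-route {i} {j} i≢j vis
      with visible-interior₃ {false} (xw i ∷ wx j ∷ xy j ∷ []) (dist-xy {false} i≢j) vis
    ... | _ , _ , xw _ , wx _ , xy _ , w∉X , x∉X = inj₁ (w∉X , x∉X)
    ... | _ , _ , xy _ , yz _ , zy _ , y∉X , z∉X = inj₂ (y∉X , z∉X)
    ... | _ , _ , xy _ , yx _ , xy _ , _        = ⊥-elim (i≢j refl)

  ∣parts∣ : ∀ bz bw (xs ys : Subset k) → ∣ bz ∷ bw ∷ xs ++ ys ∣ ≡ ∣ bz ∷ bw ∷ [] ∣ + (∣ xs ∣ + ∣ ys ∣)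
  ∣parts∣ bz bw xs ys =
    trans (∣p++q∣≡∣p∣+∣q∣ (bz ∷ bw ∷ []) (xs ++ ys)) (cong (∣ bz ∷ bw ∷ [] ∣ +_) (∣p++q∣≡∣p∣+∣q∣ xs ys))

  bound-by-parts : ∀ {P : VSubset → Set} {m} →
                   (∀ bz bw xs ys → P (bz ∷ bw ∷ xs ++ ys) → ∣ bz ∷ bw ∷ [] ∣ + (∣ xs ∣ + ∣ ys ∣) ≤ m) →
                   ∀ X → P X → ∣ X ∣ ≤ m
  bound-by-parts {m = m} bound (bz ∷ bw ∷ r) P-X with Vec.splitAt k r
  ... | xs , ys , refl = subst (_≤ m) (sym (∣parts∣ bz bw xs ys)) (bound bz bw xs ys P-X)

  module _ {bz bw : Side} {xs ys : Subset k} {i : Fin k} where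

    x∈⁺ : i ∈ xs → toVtx (vx i) ∈ bz ∷ bw ∷ xs ++ ys
    x∈⁺ i∈xs = there (there (lookup⇒[]= (i ↑ˡ k) _ (trans (lookup-++ˡ xs ys i) ([]=⇒lookup i∈xs))))

    x∈⁻ : toVtx (vx i) ∈ bz ∷ bw ∷ xs ++ ys → i ∈ xs
    x∈⁻ (there (there x∈X)) = lookup⇒[]= i xs (trans (sym (lookup-++ˡ xs ys i)) ([]=⇒lookup x∈X))

    y∈⁺ : i ∈ ys → toVtx (vy i) ∈ bz ∷ bw ∷ xs ++ ys
    y∈⁺ i∈ys = there (there (lookup⇒[]= (k ↑ʳ i) _ (trans (lookup-++ʳ xs ys i) ([]=⇒lookup i∈ys))))

    y∈⁻ : toVtx (vy i) ∈ bz ∷ bw ∷ xs ++ ys → i ∈ ys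
    y∈⁻ (there (there y∈X)) = lookup⇒[]= i ys (trans (sym (lookup-++ʳ xs ys i)) ([]=⇒lookup y∈X))

  S : (V k → Side) → VSubset
  S f = f vz ∷ f vw ∷ tabulate (f ∘ vx) ++ tabulate (f ∘ vy)

  ∣S∣ : ∀ f → ∣ S f ∣ ≡ ∣ f vz ∷ f vw ∷ [] ∣ + (∣ tabulate (f ∘ vx) ∣ + ∣ tabulate (f ∘ vy) ∣)
  ∣S∣ f = ∣parts∣ (f vz) (f vw) (tabulate (f ∘ vx)) (tabulate (f ∘ vy))

  module _ {f : V k → Side} where

    lookup-S : ∀ a → lookup (S f) (toVtx a) ≡ f a
    lookup-S vz     = refl
    lookup-S vw     = refl
    lookup-S (vx i) = trans (lookup-++ˡ (tabulate (f ∘ vx)) _ i) (lookup∘tabulate (f ∘ vx) i)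
    lookup-S (vy i) = trans (lookup-++ʳ (tabulate (f ∘ vx)) _ i) (lookup∘tabulate (f ∘ vy) i)

    ∈S⁺ : ∀ {a} → f a ≡ inside → toVtx a ∈ S f
    ∈S⁺ {a} fa = lookup⇒[]= (toVtx a) (S f) (trans (lookup-S a) fa)

    ∈S⁻ : ∀ {a} → toVtx a ∈ S f → f a ≡ inside
    ∈S⁻ {a} a∈S = trans (sym (lookup-S a)) ([]=⇒lookup a∈S)

    ∉S⁺ : ∀ {a} → f a ≡ outside → toVtx a ∉ S f
    ∉S⁺ fa a∈S with trans (sym fa) (∈S⁻ a∈S)
    ... | ()

    ∉S⁻ : ∀ {a} → toVtx a ∉ S f → f a ≡ outside
    ∉S⁻ {a} a∉S with f a in fa
    ... | inside  = ⊥-elim (a∉S (∈S⁺ fa))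
    ... | outside = refl

  ∣tabulate-const∣ : ∀ (s : Side) → ∣ tabulate {n = k} (λ _ → s) ∣ ≡ (if s then k else 0)
  ∣tabulate-const∣ s =
    trans (cong ∣_∣ (trans (tabulate-∘ (λ _ → s) id) (map-const (tabulate {n = k} id) s))) (const-card s)
    where
    const-card : ∀ s → ∣ replicate k s ∣ ≡ (if s then k else 0)
    const-card inside  = ∣⊤∣≡n k
    const-card outside = ∣⊥∣≡0 k

  clear-visible : ∀ {b a c} {f : V k → Side} (p : Path b a c (dist b a c)) →
                  All (λ s → f s ≡ outside) (interior p) → Visible (HG b k) (S f) (toVtx a) (toVtx c)
  clear-visible {f = f} p clear = shortest-visible p (All.map (∉S⁺ {f}) clear)

  module _ {G : Graph (2 + (k + k))} {f : V k → Side} where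

    IsMutualVis-S : (∀ a c → f a ≡ inside → f c ≡ inside → Visible G (S f) (toVtx a) (toVtx c)) →
                    IsMutualVis G (S f)
    IsMutualVis-S vis = ∀-toVtx {P = λ u v → u ∈ S f → v ∈ S f → Visible G (S f) u v}
      λ a c a∈S c∈S → vis a c (∈S⁻ {f} a∈S) (∈S⁻ {f} c∈S)

    IsOuterMutualVis-S : (∀ a c → f a ≡ inside → Visible G (S f) (toVtx a) (toVtx c)) →
                         IsOuterMutualVis G (S f)
    IsOuterMutualVis-S vis = ∀-toVtx {P = λ u v → u ∈ S f → Visible G (S f) u v}
      λ a c a∈S → vis a c (∈S⁻ {f} a∈S)

    IsDualMutualVis-S : (∀ a c → f a ≡ inside → f c ≡ inside → Visible G (S f) (toVtx a) (toVtx c)) →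
                        (∀ a c → f a ≡ outside → f c ≡ outside → Visible G (S f) (toVtx a) (toVtx c)) →
                        IsDualMutualVis G (S f)
    IsDualMutualVis-S visᵢ visₒ =
      ∀-toVtx {P = λ u v → (u ∈ S f × v ∈ S f) ⊎ (u ∉ S f × v ∉ S f) → Visible G (S f) u v} λ a c →
        [ (λ (a∈S , c∈S) → visᵢ a c (∈S⁻ {f} a∈S) (∈S⁻ {f} c∈S))
        , (λ (a∉S , c∉S) → visₒ a c (∉S⁻ {f} a∉S) (∉S⁻ {f} c∉S)) ]

    IsTotalMutualVis-S : (∀ a c → Visible G (S f) (toVtx a) (toVtx c)) → IsTotalMutualVis G (S f)
    IsTotalMutualVis-S = ∀-toVtx

  module _ {bz bw : Side} (xs ys : Subset k) where

    private
      X : VSubset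
      X = bz ∷ bw ∷ xs ++ ys

    xs∩ys-empty : (∀ {i} → toVtx (vx i) ∈ X → toVtx (vy i) ∉ X) → Empty (xs ∩ ys)
    xs∩ys-empty x∈⇒y∉ (_ , i∈xs∩ys) = let i∈xs , i∈ys = x∈p∩q⁻ xs ys i∈xs∩ys in x∈⇒y∉ (x∈⁺ i∈xs) (y∈⁺ i∈ys)

    ∉xs∪ys : ∀ {i} → toVtx (vx i) ∉ X → toVtx (vy i) ∉ X → i ∉ xs ∪ ys
    ∉xs∪ys x∉X y∉X i∈xs∪ys = [ x∉X ∘ x∈⁺ , y∉X ∘ y∈⁺ ] (x∈p∪q⁻ xs ys i∈xs∪ys)

    w∈⇒∣xs∣≤1 : ∀ {b} → IsMutualVis (HG b k) X → toVtx vw ∈ X → ∣ xs ∣ ≤ 1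
    w∈⇒∣xs∣≤1 {b} vis w∈X = ∣p∣≤1 {p = xs} λ i≢j i∈xs j∈xs →
      visible-xx⇒w∉ {b = b} i≢j (vis _ _ (x∈⁺ i∈xs) (x∈⁺ j∈xs)) w∈X

    z∈⇒∣ys∣≤1 : ∀ {b} → IsMutualVis (HG b k) X → toVtx vz ∈ X → ∣ ys ∣ ≤ 1
    z∈⇒∣ys∣≤1 {b} vis z∈X = ∣p∣≤1 {p = ys} λ i≢j i∈ys j∈ys →
      visible-yy⇒z∉ {b = b} i≢j (vis _ _ (y∈⁺ i∈ys) (y∈⁺ j∈ys)) z∈X

    ∣xs∩ys∣≤1 : IsMutualVis (H-e k) X → ∣ xs ∩ ys ∣ ≤ 1
    ∣xs∩ys∣≤1 vis = ∣p∣≤1 {p = xs ∩ ys} λ {i} {j} i≢j i∈xs∩ys j∈xs∩ys →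
      let i∈xs , i∈ys = x∈p∩q⁻ xs ys i∈xs∩ys
          j∈xs , j∈ys = x∈p∩q⁻ xs ys j∈xs∩ys
      in [ (λ (_ , xj∉X) → xj∉X (x∈⁺ j∈xs)) , (λ (yi∉X , _) → yi∉X (y∈⁺ i∈ys)) ]
           (visible-xy⇒free-route i≢j (vis _ _ (x∈⁺ i∈xs) (y∈⁺ j∈ys)))

    ∣xs∣≡0 : (∀ {i} → toVtx (vx i) ∉ X) → ∣ xs ∣ ≡ 0
    ∣xs∣≡0 no-x = Empty⇒∣p∣≡0 {p = xs} λ (_ , i∈xs) → no-x (x∈⁺ i∈xs)

    ∣ys∣≡0 : (∀ {i} → toVtx (vy i) ∉ X) → ∣ ys ∣ ≡ 0
    ∣ys∣≡0 no-y = Empty⇒∣p∣≡0 {p = ys} λ (_ , i∈ys) → no-y (y∈⁺ i∈ys)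

    free-rung⇒∣xs∣+∣ys∣<k : Empty (xs ∩ ys) →
                            (Σ (Fin k) λ i → toVtx (vx i) ∉ X × toVtx (vy i) ∉ X) →
                            ∣ xs ∣ + ∣ ys ∣ < k
    free-rung⇒∣xs∣+∣ys∣<k disjoint (_ , x∉X , y∉X) = disjoint⇒∣p∣+∣q∣<n xs ys disjoint (∉xs∪ys x∉X y∉X)

    z∈⇒xs∩ys-empty : IsMutualVis (H-e k) X → toVtx vz ∈ X → Empty (xs ∩ ys)
    z∈⇒xs∩ys-empty vis z∈X = xs∩ys-empty λ x∈X → visible-zx⇒y∉ (vis _ _ z∈X x∈X)

    w∈⇒xs∩ys-empty : IsMutualVis (H-e k) X → toVtx vw ∈ X → Empty (xs ∩ ys)
    w∈⇒xs∩ys-empty vis w∈X = xs∩ys-empty λ x∈X y∈X → visible-wy⇒x∉ (vis _ _ w∈X y∈X) x∈X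

    outer⇒xs∩ys-empty : IsOuterMutualVis (H-e k) X → Empty (xs ∩ ys)
    outer⇒xs∩ys-empty outer = xs∩ys-empty λ x∈X → visible-xz⇒y∉ (outer _ _ x∈X)

-- Extremal sets and upper bounds for k ≥ 2

module AtLeastTwoRungs (k′ : ℕ) where

  k : ℕ
  k = 2 + k′

  another : (i : Fin k) → Σ (Fin k) (i ≢_)
  another zero    = suc zero , 0≢1+n
  another (suc _) = zero , 0≢1+n ∘ sym

  rim : V k → Side
  rim vz     = outside
  rim vw     = outside
  rim (vx _) = inside
  rim (vy _) = inside

  rim-total : IsTotalMutualVis (H k) (S rim)
  rim-total = IsTotalMutualVis-S {f = rim} λ a c → clear-visible {f = rim} (routeH a c) (hub-interior a c)
    where
    hub-interior : ∀ a c → All (λ s → rim s ≡ outside) (interior (routeH a c))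
    hub-interior vz     vz     = []
    hub-interior vz     vw     = []
    hub-interior vz     (vx i) = refl ∷ []
    hub-interior vz     (vy i) = []
    hub-interior vw     vz     = []
    hub-interior vw     vw     = []
    hub-interior vw     (vx i) = []
    hub-interior vw     (vy i) = refl ∷ []
    hub-interior (vx i) vz     = refl ∷ []
    hub-interior (vx i) vw     = []
    hub-interior (vx i) (vx j) with i ≟ j
    ... | yes refl = []
    ... | no _     = refl ∷ []
    hub-interior (vx i) (vy j) with i ≟ j
    ... | yes refl = []
    ... | no _     = refl ∷ refl ∷ []
    hub-interior (vy i) vz     = []
    hub-interior (vy i) vw     = refl ∷ []
    hub-interior (vy i) (vx j) with i ≟ j
    ... | yes refl = []
    ... | no _     = refl ∷ refl ∷ []
    hub-interior (vy i) (vy j) with i ≟ j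
    ... | yes refl = []
    ... | no _     = refl ∷ []

  ∣S-rim∣ : ∣ S rim ∣ ≡ k + k
  ∣S-rim∣ = trans (∣S∣ rim) (cong₂ _+_ (∣tabulate-const∣ {k} inside) (∣tabulate-const∣ {k} inside))

  y-side∪w : V k → Side
  y-side∪w vz     = outside
  y-side∪w vw     = inside
  y-side∪w (vx _) = outside
  y-side∪w (vy _) = inside

  y-side∪w-mutual : IsMutualVis (H-e k) (S y-side∪w)
  y-side∪w-mutual = IsMutualVis-S {f = y-side∪w} λ a c a∈ c∈ →
    clear-visible {f = y-side∪w} (routeH-e zero a c) (clear a c a∈ c∈)
    where
    clear : ∀ a c → y-side∪w a ≡ inside → y-side∪w c ≡ inside →
            All (λ s → y-side∪w s ≡ outside) (interior (routeH-e zero a c))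
    clear vw     vw     _ _ = []
    clear vw     (vy i) _ _ = refl ∷ []
    clear (vy i) vw     _ _ = refl ∷ []
    clear (vy i) (vy j) _ _ with i ≟ j
    ... | yes refl = []
    ... | no _     = refl ∷ []
    clear vz     _      () _
    clear (vx _) _      () _
    clear vw     vz     _ ()
    clear vw     (vx _) _ ()
    clear (vy _) vz     _ ()
    clear (vy _) (vx _) _ ()

  ∣S-y-side∪w∣ : ∣ S y-side∪w ∣ ≡ 1 + k
  ∣S-y-side∪w∣ =
    trans (∣S∣ y-side∪w) (cong suc (cong₂ _+_ (∣tabulate-const∣ {k} outside) (∣tabulate-const∣ {k} inside)))

  y-side : V k → Side
  y-side (vy _) = inside
  y-side _      = outside

  y-side-outer : IsOuterMutualVis (H-e k) (S y-side)
  y-side-outer = IsOuterMutualVis-S {f = y-side} λ a c a∈ →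
    clear-visible {f = y-side} (routeH-e zero a c) (clear a c a∈)
    where
    clear : ∀ a c → y-side a ≡ inside → All (λ s → y-side s ≡ outside) (interior (routeH-e zero a c))
    clear (vy i) vz     _ = []
    clear (vy i) vw     _ = refl ∷ []
    clear (vy i) (vx j) _ with i ≟ j
    ... | yes refl = []
    ... | no _     = refl ∷ refl ∷ []
    clear (vy i) (vy j) _ with i ≟ j
    ... | yes refl = []
    ... | no _     = refl ∷ []
    clear vz     _ ()
    clear vw     _ ()
    clear (vx _) _ ()

  ∣S-y-side∣ : ∣ S y-side ∣ ≡ k
  ∣S-y-side∣ = trans (∣S∣ y-side) (cong₂ _+_ (∣tabulate-const∣ {k} outside) (∣tabulate-const∣ {k} inside))

  is-zero : Fin k → Side
  is-zero zero    = inside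
  is-zero (suc _) = outside

  rung₀ : V k → Side
  rung₀ vz     = outside
  rung₀ vw     = outside
  rung₀ (vx i) = is-zero i
  rung₀ (vy i) = is-zero i

  rung₀-dual : IsDualMutualVis (H-e k) (S rung₀)
  rung₀-dual = IsDualMutualVis-S {f = rung₀}
    (λ a c a∈ c∈ → clear-visible {f = rung₀} (routeH-e zero a c) (inner a c a∈ c∈))
    (λ a c a∉ c∉ → clear-visible {f = rung₀} (routeH-e (suc zero) a c)
                     (routeH-e-interior refl refl id id (suc zero) a c refl a∉ c∉))
    where
    inner : ∀ a c → rung₀ a ≡ inside → rung₀ c ≡ inside →
            All (λ s → rung₀ s ≡ outside) (interior (routeH-e zero a c))
    inner (vx zero) (vx zero) _ _ = []
    inner (vx zero) (vy zero) _ _ = []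
    inner (vy zero) (vx zero) _ _ = []
    inner (vy zero) (vy zero) _ _ = []
    inner vz          _           () _
    inner vw          _           () _
    inner (vx (suc _)) _          () _
    inner (vy (suc _)) _          () _
    inner (vx zero)   vz          _ ()
    inner (vx zero)   vw          _ ()
    inner (vx zero)   (vx (suc _)) _ ()
    inner (vx zero)   (vy (suc _)) _ ()
    inner (vy zero)   vz          _ ()
    inner (vy zero)   vw          _ ()
    inner (vy zero)   (vx (suc _)) _ ()
    inner (vy zero)   (vy (suc _)) _ ()

  ∣S-rung₀∣ : ∣ S rung₀ ∣ ≡ 2
  ∣S-rung₀∣ = trans (∣S∣ rung₀)
    (cong₂ (λ m n → suc m + suc n) (∣tabulate-const∣ {suc k′} outside) (∣tabulate-const∣ {suc k′} outside))

  none : V k → Side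
  none _ = outside

  none-total : IsTotalMutualVis (H-e k) (S none)
  none-total = IsTotalMutualVis-S {f = none} λ a c →
    clear-visible {f = none} (routeH-e zero a c) (All.universal (λ _ → refl) _)

  ∣S-none∣ : ∣ S none ∣ ≡ 0
  ∣S-none∣ = trans (∣S∣ none) (cong₂ _+_ (∣tabulate-const∣ {k} outside) (∣tabulate-const∣ {k} outside))

  0≢1 : _≢_ {A = Fin k} zero (suc zero)
  0≢1 = 0≢1+n

  mutual-H-bound : ∀ X → IsMutualVis (H k) X → ∣ X ∣ ≤ k + k
  mutual-H-bound = bound-by-parts bound
    where
    ∣xs∣<k : ∀ {bz} xs ys → IsMutualVis (H k) (bz ∷ inside ∷ xs ++ ys) → ∣ xs ∣ < k
    ∣xs∣<k xs ys vis = s≤s (≤-trans (w∈⇒∣xs∣≤1 xs ys {b = true} vis (there here)) (s≤s z≤n))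

    ∣ys∣<k : ∀ {bw} xs ys → IsMutualVis (H k) (inside ∷ bw ∷ xs ++ ys) → ∣ ys ∣ < k
    ∣ys∣<k xs ys vis = s≤s (≤-trans (z∈⇒∣ys∣≤1 xs ys {b = true} vis here) (s≤s z≤n))

    bound : ∀ bz bw xs ys → IsMutualVis (H k) (bz ∷ bw ∷ xs ++ ys) →
            ∣ bz ∷ bw ∷ [] ∣ + (∣ xs ∣ + ∣ ys ∣) ≤ k + k
    bound outside outside xs ys vis = +-mono-≤ (∣p∣≤n xs) (∣p∣≤n ys)
    bound outside inside  xs ys vis = +-mono-≤ (∣xs∣<k xs ys vis) (∣p∣≤n ys)
    bound inside  outside xs ys vis = subst (_≤ k + k) (+-suc ∣ xs ∣ ∣ ys ∣) (+-mono-≤ (∣p∣≤n xs) (∣ys∣<k xs ys vis))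
    bound inside  inside  xs ys vis =
      subst (_≤ k + k) (cong suc (+-suc ∣ xs ∣ ∣ ys ∣)) (+-mono-≤ (∣xs∣<k xs ys vis) (∣ys∣<k xs ys vis))

  mutual-H-e-bound : ∀ X → IsMutualVis (H-e k) X → ∣ X ∣ ≤ 1 + k
  mutual-H-e-bound = bound-by-parts bound
    where
    bound : ∀ bz bw xs ys → IsMutualVis (H-e k) (bz ∷ bw ∷ xs ++ ys) →
            ∣ bz ∷ bw ∷ [] ∣ + (∣ xs ∣ + ∣ ys ∣) ≤ 1 + k
    bound outside outside xs ys vis = ∣p∩q∣≤1⇒∣p∣+∣q∣≤1+n xs ys (∣xs∩ys∣≤1 xs ys vis)
    bound inside  outside xs ys vis = s≤s (disjoint⇒∣p∣+∣q∣≤n xs ys (z∈⇒xs∩ys-empty xs ys vis here))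
    bound outside inside  xs ys vis = s≤s (disjoint⇒∣p∣+∣q∣≤n xs ys (w∈⇒xs∩ys-empty xs ys vis (there here)))
    bound inside  inside  xs ys vis = s≤s (free-rung⇒∣xs∣+∣ys∣<k xs ys (z∈⇒xs∩ys-empty xs ys vis here)
      (visible-zw⇒free-rung zero (vis _ _ here (there here))))

  outer-H-e-bound : ∀ X → IsOuterMutualVis (H-e k) X → ∣ X ∣ ≤ k
  outer-H-e-bound = bound-by-parts bound
    where
    bound : ∀ bz bw xs ys → IsOuterMutualVis (H-e k) (bz ∷ bw ∷ xs ++ ys) →
            ∣ bz ∷ bw ∷ [] ∣ + (∣ xs ∣ + ∣ ys ∣) ≤ k
    bound outside outside xs ys out = disjoint⇒∣p∣+∣q∣≤n xs ys (outer⇒xs∩ys-empty xs ys out)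
    bound inside  outside xs ys out =
      free-rung⇒∣xs∣+∣ys∣<k xs ys (outer⇒xs∩ys-empty xs ys out) (visible-zw⇒free-rung zero (out _ _ here))
    bound outside inside  xs ys out =
      free-rung⇒∣xs∣+∣ys∣<k xs ys (outer⇒xs∩ys-empty xs ys out) (visible-wz⇒free-rung zero (out _ _ (there here)))
    bound inside  inside  xs ys out =
      s≤s (s≤s (≤-trans (+-mono-≤ (≤-reflexive (∣xs∣≡0 xs ys no-x)) (≤-reflexive (∣ys∣≡0 xs ys no-y))) z≤n))
      where
      no-x : ∀ {i} → toVtx (vx i) ∉ inside ∷ inside ∷ xs ++ ys
      no-x {i} x∈X = visible-xx⇒w∉ {b = false} (proj₂ (another i)) (out _ _ x∈X) (there here)
      no-y : ∀ {i} → toVtx (vy i) ∉ inside ∷ inside ∷ xs ++ ys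
      no-y {i} y∈X = visible-yy⇒z∉ {b = false} (proj₂ (another i)) (out _ _ y∈X) here

  total-H-e-bound : ∀ X → IsTotalMutualVis (H-e k) X → ∣ X ∣ ≤ 0
  total-H-e-bound = bound-by-parts bound
    where
    bound : ∀ bz bw xs ys → IsTotalMutualVis (H-e k) (bz ∷ bw ∷ xs ++ ys) →
            ∣ bz ∷ bw ∷ [] ∣ + (∣ xs ∣ + ∣ ys ∣) ≤ 0
    bound inside  _       xs ys total = ⊥-elim (visible-yy⇒z∉ {b = false} 0≢1 (total _ _) here)
    bound outside inside  xs ys total = ⊥-elim (visible-xx⇒w∉ {b = false} 0≢1 (total _ _) (there here))
    bound outside outside xs ys total = ≤-reflexive (cong₂ _+_
      (∣xs∣≡0 xs ys λ x∈X → visible-wy⇒x∉ (total _ _) x∈X)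
      (∣ys∣≡0 xs ys λ y∈X → visible-zx⇒y∉ (total _ _) y∈X))

  module _ {bz bw : Side} (xs ys : Subset k) (dual : IsDualMutualVis (H-e k) (bz ∷ bw ∷ xs ++ ys)) where

    private
      D : Subset (2 + (k + k))
      D = bz ∷ bw ∷ xs ++ ys

      inner : ∀ {u v} → u ∈ D → v ∈ D → Visible (H-e k) D u v
      inner u∈D v∈D = dual _ _ (inj₁ (u∈D , v∈D))

      outer : ∀ {u v} → u ∉ D → v ∉ D → Visible (H-e k) D u v
      outer u∉D v∉D = dual _ _ (inj₂ (u∉D , v∉D))

    z∈⇒some-y : zv k ∈ D → Σ (Fin k) λ a → toVtx (vy a) ∈ D
    z∈⇒some-y z∈D with toVtx (vy zero) ∈? D | toVtx (vy (suc zero)) ∈? D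
    ... | yes y₀∈D | _        = zero , y₀∈D
    ... | no _     | yes y₁∈D = suc zero , y₁∈D
    ... | no y₀∉D  | no y₁∉D  = ⊥-elim (visible-yy⇒z∉ {b = false} 0≢1 (outer y₀∉D y₁∉D) z∈D)

    z∈⇒w∉ : zv k ∈ D → wv k ∉ D
    z∈⇒w∉ z∈D w∈D = blocked (z∈⇒some-y z∈D) (visible-zw⇒free-rung zero (inner z∈D w∈D))
      where
      blocked : (Σ (Fin k) λ a → toVtx (vy a) ∈ D) → (Σ (Fin k) λ c → toVtx (vx c) ∉ D × toVtx (vy c) ∉ D) → ⊥
      blocked (a , ya∈D) (c , xc∉D , yc∉D) = visible-xx⇒w∉ {b = false} a≢c (outer xa∉D xc∉D) w∈D
        where
        xa∉D : toVtx (vx a) ∉ D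
        xa∉D xa∈D = visible-zx⇒y∉ (inner z∈D xa∈D) ya∈D
        a≢c : a ≢ c
        a≢c refl = yc∉D ya∈D

    z∈⇒x∉ : zv k ∈ D → ∀ {i} → toVtx (vx i) ∉ D
    z∈⇒x∉ z∈D xi∈D = visible-wy⇒x∉ (outer (z∈⇒w∉ z∈D) (visible-zx⇒y∉ (inner z∈D xi∈D))) xi∈D

    w∈⇒z∉⇒y∉ : wv k ∈ D → zv k ∉ D → ∀ {i} → toVtx (vy i) ∉ D
    w∈⇒z∉⇒y∉ w∈D z∉D yi∈D = visible-zx⇒y∉ (outer z∉D (visible-wy⇒x∉ (inner w∈D yi∈D))) yi∈D

    w∉⇒x∈⇒y∈ : wv k ∉ D → ∀ {i} → toVtx (vx i) ∈ D → toVtx (vy i) ∈ D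
    w∉⇒x∈⇒y∈ w∉D {i} xi∈D with toVtx (vy i) ∈? D
    ... | yes yi∈D = yi∈D
    ... | no yi∉D  = ⊥-elim (visible-wy⇒x∉ (outer w∉D yi∉D) xi∈D)

    z∉⇒y∈⇒x∈ : zv k ∉ D → ∀ {i} → toVtx (vy i) ∈ D → toVtx (vx i) ∈ D
    z∉⇒y∈⇒x∈ z∉D {i} yi∈D with toVtx (vx i) ∈? D
    ... | yes xi∈D = xi∈D
    ... | no xi∉D  = ⊥-elim (visible-zx⇒y∉ (outer z∉D xi∉D) yi∈D)

  dual-H-e-bound : ∀ X → IsDualMutualVis (H-e k) X → ∣ X ∣ ≤ 2
  dual-H-e-bound = bound-by-parts bound
    where
    bound : ∀ bz bw xs ys → IsDualMutualVis (H-e k) (bz ∷ bw ∷ xs ++ ys) →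
            ∣ bz ∷ bw ∷ [] ∣ + (∣ xs ∣ + ∣ ys ∣) ≤ 2
    bound inside  inside  xs ys dual = ⊥-elim (z∈⇒w∉ xs ys dual here (there here))
    bound inside  outside xs ys dual = s≤s (+-mono-≤
      (≤-reflexive (∣xs∣≡0 xs ys (z∈⇒x∉ xs ys dual here)))
      (z∈⇒∣ys∣≤1 xs ys {b = false} (IsDualMutualVis⇒IsMutualVis dual) here))
    bound outside inside  xs ys dual = s≤s (+-mono-≤
      (w∈⇒∣xs∣≤1 xs ys {b = false} (IsDualMutualVis⇒IsMutualVis dual) (there here))
      (≤-reflexive (∣ys∣≡0 xs ys (w∈⇒z∉⇒y∉ xs ys dual (there here) λ ()))))
    bound outside outside xs ys dual = +-mono-≤
      (≤-trans (p⊆q⇒∣p∣≤∣q∣ xs⊆xs∩ys) ∣xs∩ys∣≤1′)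
      (≤-trans (p⊆q⇒∣p∣≤∣q∣ ys⊆xs∩ys) ∣xs∩ys∣≤1′)
      where
      ∣xs∩ys∣≤1′ : ∣ xs ∩ ys ∣ ≤ 1
      ∣xs∩ys∣≤1′ = ∣xs∩ys∣≤1 xs ys (IsDualMutualVis⇒IsMutualVis dual)
      xs⊆xs∩ys : xs ⊆ xs ∩ ys
      xs⊆xs∩ys i∈xs = x∈p∩q⁺ (i∈xs , y∈⁻ {xs = xs} {ys} (w∉⇒x∈⇒y∈ xs ys dual (λ { (there ()) }) (x∈⁺ i∈xs)))
      ys⊆xs∩ys : ys ⊆ xs ∩ ys
      ys⊆xs∩ys i∈ys = x∈p∩q⁺ (x∈⁻ {xs = xs} {ys} (z∉⇒y∈⇒x∈ xs ys dual (λ ()) (y∈⁺ i∈ys)) , i∈ys)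

proposition3p1 : (k : ℕ) → 2 ≤ k →
    (μ≡ (H k) (k + k) × μo≡ (H k) (k + k) × μd≡ (H k) (k + k) × μt≡ (H k) (k + k))
    × (μ≡ (H-e k) (1 + k) × μo≡ (H-e k) k)
    × (μd≡ (H-e k) 2 × μt≡ (H-e k) 0)
proposition3p1 (suc zero) (s≤s ())
proposition3p1 (suc (suc k′)) _ =
  ( ( (S rim , IsOuterMutualVis⇒IsMutualVis rim-outer , ∣S-rim∣) , mutual-H-bound)
  , ( (S rim , rim-outer , ∣S-rim∣) , λ X → mutual-H-bound X ∘ IsOuterMutualVis⇒IsMutualVis)
  , ( (S rim , IsTotalMutualVis⇒IsDualMutualVis rim-total , ∣S-rim∣)
    , λ X → mutual-H-bound X ∘ IsDualMutualVis⇒IsMutualVis)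
  , ( (S rim , rim-total , ∣S-rim∣)
    , λ X → mutual-H-bound X ∘ IsOuterMutualVis⇒IsMutualVis ∘ IsTotalMutualVis⇒IsOuterMutualVis) )
  , ( ( (S y-side∪w , y-side∪w-mutual , ∣S-y-side∪w∣) , mutual-H-e-bound)
    , ( (S y-side , y-side-outer , ∣S-y-side∣) , outer-H-e-bound) )
  , ( ( (S rung₀ , rung₀-dual , ∣S-rung₀∣) , dual-H-e-bound)
    , ( (S none , none-total , ∣S-none∣) , total-H-e-bound) )
  where
  open AtLeastTwoRungs k′
  rim-outer : IsOuterMutualVis (H k) (S rim)
  rim-outer = IsTotalMutualVis⇒IsOuterMutualVis rim-total
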